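{- For every $p\ge 0$, $$A_{p+1}(q)=\sum_{k=0}^{p}\left(C_kC_{p-k}q^{k+1}+C_{p-k}q^{k+1}A_k(q)+C_kA_{p-k}(q)\right),$$ and consequently the formal power series $A(t,q)=\sum_{p\ge0}A_p(q)t^p$ satisfies $$A(t,q)=\frac{(1-\sqrt{1-4t})(1-\sqrt{1-4qt})}{4t}+q\,\frac{1-\sqrt{1-4t}}{2}\,A(qt,q)+\frac{1-\sqrt{1-4t}}{2}\,A(t,q).$$
   Context: $C_k=\frac{1}{k+1}\binom{2k}{k}$ is the $k$-th Catalan number. $\mathcal{T}_n$ denotes the set of rooted plane (ordered) trees with $n$ edges. For a rooted tree $T$, the vertices are labeled as follows: the root is labeled $0$, and a child $v$ of a vertex labeled $\mu$ is labeled $\mu+$ (number of vertices in the subtree consisting of $v$ and all its descendants). The avalanche polynomial is $Av_T(q)=\sum_{i\ge1}p_iq^i$, with $p_i$ the number of vertices labeled $i$. Define $A_n(q)=\sum_{T\in\mathcal{T}_n}Av_T(q)$ (so $A_0(q)=0$). -}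

module Defs where

open import Data.Nat using (ℕ; zero; suc; _+_; _*_; _∸_; _≤ᵇ_; _≡ᵇ_)
open import Data.Nat.DivMod using (_/_)
open import Data.Nat.Combinatorics using (_C_)
open import Data.Bool using (if_then_else_)
open import Data.List using (List; []; _∷_; _++_; concatMap; map; length; filter; upTo)
open import Data.Nat.ListAction using (sum)
open import Data.Integer as ℤ using (ℤ; +_)
open import Relation.Binary.PropositionalEquality using (_≡_)
open import Data.Nat using (_≟_)

Cat : ℕ → ℕ
Cat k = ((2 * k) C k) / suc k

-- Rooted plane (ordered) trees: a vertex with an ordered list of children

data Tree : Set where
  node : List Tree → Tree

mutual
  vertices : Tree → ℕ
  vertices (node ts) = suc (verticesF ts)

  verticesF : List Tree → ℕ
  verticesF []       = 0
  verticesF (t ∷ ts) = vertices t + verticesF ts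

-- number of edges = number of vertices - 1
edges : Tree → ℕ
edges (node ts) = verticesF ts

-- List of all forests (ordered lists of plane trees) with exactly m vertices,
-- generated with a fuel argument (fuel ≥ m+1 suffices).  The first tree of a
-- nonempty forest with suc m vertices has suc k vertices (k ≤ m) and
-- the remaining forest has m ∸ k vertices.
forestsF : ℕ → ℕ → List (List Tree)
forestsF zero    _       = []
forestsF (suc f) zero    = [] ∷ []
forestsF (suc f) (suc m) =
  concatMap (λ k → concatMap (λ ts → map (λ rest → node ts ∷ rest)
                                          (forestsF f (m ∸ k)))
                             (forestsF f k))
            (upTo (suc m))

-- 𝒯_n : the list of all rooted plane trees with n edges
-- (a tree with n edges is a root together with a forest with n vertices)
𝒯 : ℕ → List Tree
𝒯 n = map node (forestsF (suc n) n)

-- Vertex labels: root labelled μ₀ = 0; a child v of a vertex labelled μ is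
-- labelled μ + (number of vertices of the subtree rooted at v).
-- labels μ t lists the labels of all vertices of t, when the root of t has label μ.

mutual
  labels : ℕ → Tree → List ℕ
  labels μ (node ts) = μ ∷ labelsChildren μ ts

  labelsChildren : ℕ → List Tree → List ℕ
  labelsChildren μ []       = []
  labelsChildren μ (t ∷ ts) = labels (μ + vertices t) t ++ labelsChildren μ ts

count : ℕ → List ℕ → ℕ
count i xs = length (filter (λ x → x ≟ i) xs)

-- Avalanche polynomial Av_T(q) = Σ_{i ≥ 1} p_i q^i, as its coefficient function
Av : Tree → ℕ → ℕ
Av T zero    = 0
Av T (suc i) = count (suc i) (labels 0 T)

-- A_n(q) = Σ_{T ∈ 𝒯_n} Av_T(q), as coefficient function (coefficient of q^i)
A : ℕ → ℕ → ℕ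
A n i = sum (map (λ T → Av T i) (𝒯 n))

Σ≤ : ℕ → (ℕ → ℕ) → ℕ
Σ≤ zero    f = f 0
Σ≤ (suc n) f = Σ≤ n f + f (suc n)

Σ≤ℤ : ℕ → (ℕ → ℤ) → ℤ
Σ≤ℤ zero    f = f 0
Σ≤ℤ (suc n) f = Σ≤ℤ n f ℤ.+ f (suc n)

-- coefficient of q^i in q^m · P(q), P given by coefficients
shiftq : ℕ → (ℕ → ℕ) → ℕ → ℕ
shiftq m P i = if m ≤ᵇ i then P (i ∸ m) else 0

-- coefficient of q^i in q^m
qpow : ℕ → ℕ → ℕ
qpow m i = if m ≡ᵇ i then 1 else 0

-- Formal power series in t with coefficients in ℤ[q] (ℤ[[t,q]]):
-- F p i = coefficient of t^p q^i.

Series : Set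
Series = ℕ → ℕ → ℤ

_≈ₛ_ : Series → Series → Set
F ≈ₛ G = ∀ p i → F p i ≡ G p i

infix 4 _≈ₛ_
infixl 6 _⊕_ _⊖_
infixl 7 _⊗_ _·_

_⊕_ : Series → Series → Series
(F ⊕ G) p i = F p i ℤ.+ G p i

_⊖_ : Series → Series → Series
(F ⊖ G) p i = F p i ℤ.- G p i

_·_ : ℤ → Series → Series
(c · F) p i = c ℤ.* F p i

_⊗_ : Series → Series → Series
(F ⊗ G) p i = Σ≤ℤ p (λ a → Σ≤ℤ i (λ b → F a b ℤ.* G (p ∸ a) (i ∸ b)))

𝟙 : Series
𝟙 zero    zero = + 1
𝟙 _       _    = + 0

𝕥 : Series
𝕥 1 zero = + 1
𝕥 _ _    = + 0

𝕢 : Series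
𝕢 zero 1 = + 1
𝕢 _    _ = + 0

-- substitution t ↦ q t :  F(qt, q)
subst-qt : Series → Series
subst-qt F p i = if p ≤ᵇ i then F p (i ∸ p) else + 0

-- a power series in t alone, viewed in ℤ[[t,q]]
embedT : (ℕ → ℤ) → Series
embedT s p zero    = s p
embedT s p (suc i) = + 0

𝒜 : Series
𝒜 p i = + A p i

-- The avalanche polynomials summed over all plane trees with p+1 edges are
-- computed by removing the first subtree of the root.  A tree with p+1 edges is
-- a root over a forest with p+1 vertices, which splits into a first tree (a root
-- over a forest with k vertices) and a remaining forest with p−k vertices.  The
-- first subtree contributes its root label k+1 and its own avalanche labels
-- shifted by k+1; the rest contributes the avalanche labels of the tree it
-- forms.  Summing over the Cat k · Cat (p−k) pairs gives the recurrence, since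
-- there are Cat m forests with m vertices (same decomposition plus Segner's
-- recurrence, derived from the closed form of Cat via ballot numbers).
-- For the generating function, a series s with s(0) = 1 and s² = 1 − 4t is
-- forced to be √(1 − 4t), so 1 − s = Σ 2 Cat n t^(n+1); both sides then become
-- natural-coefficient series, where the identity is 4 × the recurrence.
module Submission where

open import Defs
open import Data.Nat using (ℕ; zero; suc; _+_; _*_; _∸_; _≤_; _<_; z≤n; s≤s; _≤ᵇ_; _≡ᵇ_; _≟_)
open import Data.Nat.Properties
open import Algebra.Properties.CommutativeSemigroup +-commutativeSemigroup using (interchange)
open import Data.Nat.Combinatorics using (_C_; nCk+nC[k+1]≡[n+1]C[k+1]; nCk≡nC[n∸k]; nC1≡n; k>n⇒nCk≡0)
open import Data.Nat.DivMod using (_/_; m*n/n≡m)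
open import Data.Nat.ListAction using (sum)
open import Data.Nat.ListAction.Properties using (sum-++)
open import Data.Nat.Tactic.RingSolver using (solve-∀)
open import Data.Bool using (true; false; if_then_else_)
open import Data.List using (List; []; _∷_; _++_; concatMap; concat; map; length; filter; upTo; applyUpTo)
open import Data.List.Properties using (map-++; map-∘; map-cong; map-cong-local; length-++; filter-++)
open import Data.List.Relation.Unary.All as All using (All; []; _∷_)
open import Data.List.Relation.Unary.All.Properties using (concat⁺; map⁺; applyUpTo⁺₁)
open import Relation.Binary.PropositionalEquality
open ≡-Reasoning

Σ≤-cong≤ : ∀ n {f g : ℕ → ℕ} → (∀ k → k ≤ n → f k ≡ g k) → Σ≤ n f ≡ Σ≤ n g
Σ≤-cong≤ zero    e = e 0 z≤n
Σ≤-cong≤ (suc n) e = cong₂ _+_ (Σ≤-cong≤ n (λ k k≤n → e k (m≤n⇒m≤1+n k≤n))) (e (suc n) ≤-refl)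

Σ≤-cong : ∀ n {f g : ℕ → ℕ} → (∀ k → f k ≡ g k) → Σ≤ n f ≡ Σ≤ n g
Σ≤-cong n e = Σ≤-cong≤ n (λ k _ → e k)

Σ≤-head : ∀ n (f : ℕ → ℕ) → Σ≤ (suc n) f ≡ f 0 + Σ≤ n (λ k → f (suc k))
Σ≤-head zero    f = refl
Σ≤-head (suc n) f = trans (cong (_+ f (suc (suc n))) (Σ≤-head n f)) (+-assoc (f 0) _ _)

Σ≤-+ : ∀ n (f g : ℕ → ℕ) → Σ≤ n (λ k → f k + g k) ≡ Σ≤ n f + Σ≤ n g
Σ≤-+ zero    f g = refl
Σ≤-+ (suc n) f g = trans (cong (_+ (f (suc n) + g (suc n))) (Σ≤-+ n f g))
                         (interchange (Σ≤ n f) (Σ≤ n g) (f (suc n)) (g (suc n)))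

Σ≤-* : ∀ n c (f : ℕ → ℕ) → Σ≤ n (λ k → c * f k) ≡ c * Σ≤ n f
Σ≤-* zero    c f = refl
Σ≤-* (suc n) c f = trans (cong (_+ c * f (suc n)) (Σ≤-* n c f)) (sym (*-distribˡ-+ c (Σ≤ n f) (f (suc n))))

Σ≤-zero : ∀ n → Σ≤ n (λ _ → 0) ≡ 0
Σ≤-zero zero    = refl
Σ≤-zero (suc n) = trans (+-identityʳ _) (Σ≤-zero n)

Σ≤-first : ∀ n (f : ℕ → ℕ) → (∀ k → f (suc k) ≡ 0) → Σ≤ n f ≡ f 0
Σ≤-first zero    f e = refl
Σ≤-first (suc n) f e = trans (cong₂ _+_ (Σ≤-first n f e) (e n)) (+-identityʳ (f 0))

Σ≤-reverse : ∀ n (f : ℕ → ℕ) → Σ≤ n f ≡ Σ≤ n (λ k → f (n ∸ k))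
Σ≤-reverse zero    f = refl
Σ≤-reverse (suc n) f = begin
  Σ≤ n f + f (suc n)                    ≡⟨ cong (_+ f (suc n)) (Σ≤-reverse n f) ⟩
  Σ≤ n (λ k → f (n ∸ k)) + f (suc n)    ≡⟨ +-comm _ (f (suc n)) ⟩
  f (suc n) + Σ≤ n (λ k → f (n ∸ k))    ≡⟨ Σ≤-head n (λ k → f (suc n ∸ k)) ⟨
  Σ≤ (suc n) (λ k → f (suc n ∸ k))      ∎

Σ≤-antidiagonal-last : ∀ n (h : ℕ → ℕ → ℕ) →
  Σ≤ (suc n) (λ j → h j (suc n ∸ j)) ≡ Σ≤ n (λ j → h j (suc (n ∸ j))) + h (suc n) 0
Σ≤-antidiagonal-last n h =
  cong₂ _+_ (Σ≤-cong≤ n (λ j j≤n → cong (h j) (+-∸-assoc 1 j≤n))) (cong (h (suc n)) (n∸n≡0 n))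

Σ≤-reflect : ∀ n (h : ℕ → ℕ → ℕ) → Σ≤ n (λ k → h k (n ∸ k)) ≡ Σ≤ n (λ k → h (n ∸ k) k)
Σ≤-reflect n h = trans (Σ≤-reverse n _) (Σ≤-cong≤ n (λ k k≤n → cong (h (n ∸ k)) (m∸[m∸n]≡n k≤n)))

-- Ballot numbers: ballot b k counts the lattice paths with b up-steps that
-- start at height k, end at height 0 and never go below 0 (recursion on the
-- first step).  The Catalan numbers are the ballot numbers with k = 0.
ballot : ℕ → ℕ → ℕ
ballot zero    k       = 1
ballot (suc b) zero    = ballot b 1
ballot (suc b) (suc k) = ballot (suc b) k + ballot b (suc (suc k))

-- First-passage decomposition: a path from height k+1 splits at its first
-- visit to height k into a Dyck path and a path from height k.
ballot-convolution : ∀ b k → ballot b (suc k) ≡ Σ≤ b (λ j → ballot j 0 * ballot (b ∸ j) k)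
ballot-convolution zero    k       = refl
ballot-convolution (suc b) zero    = begin
  ballot b 1 + ballot b 2
    ≡⟨ cong (ballot b 1 +_) (ballot-convolution b 1) ⟩
  ballot b 1 + Σ≤ b (λ j → ballot j 0 * ballot (suc (b ∸ j)) 0)
    ≡⟨ +-comm (ballot b 1) _ ⟩
  Σ≤ b (λ j → ballot j 0 * ballot (suc (b ∸ j)) 0) + ballot b 1
    ≡⟨ cong (Σ≤ b (λ j → ballot j 0 * ballot (suc (b ∸ j)) 0) +_) (*-identityʳ (ballot b 1)) ⟨
  Σ≤ b (λ j → ballot j 0 * ballot (suc (b ∸ j)) 0) + ballot (suc b) 0 * ballot 0 0
    ≡⟨ Σ≤-antidiagonal-last b (λ j i → ballot j 0 * ballot i 0) ⟨
  Σ≤ (suc b) (λ j → ballot j 0 * ballot (suc b ∸ j) 0) ∎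
ballot-convolution (suc b) (suc k) = begin
  ballot (suc b) (suc k) + ballot b (3 + k)
    ≡⟨ cong₂ _+_ (trans (ballot-convolution (suc b) k) (Σ≤-antidiagonal-last b (λ j i → ballot j 0 * ballot i k)))
                 (ballot-convolution b (2 + k)) ⟩
  (S₁ + last) + S₂    ≡⟨ +-assoc S₁ last S₂ ⟩
  S₁ + (last + S₂)    ≡⟨ cong (S₁ +_) (+-comm last S₂) ⟩
  S₁ + (S₂ + last)    ≡⟨ +-assoc S₁ S₂ last ⟨
  (S₁ + S₂) + last
    ≡⟨ cong (_+ last) (Σ≤-+ b (λ j → ballot j 0 * ballot (suc (b ∸ j)) k) (λ j → ballot j 0 * ballot (b ∸ j) (2 + k))) ⟨
  Σ≤ b (λ j → ballot j 0 * ballot (suc (b ∸ j)) k + ballot j 0 * ballot (b ∸ j) (2 + k)) + last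
    ≡⟨ cong (_+ last) (Σ≤-cong b (λ j → *-distribˡ-+ (ballot j 0) _ _)) ⟨
  Σ≤ b (λ j → ballot j 0 * ballot (suc (b ∸ j)) (suc k)) + ballot (suc b) 0 * ballot 0 (suc k)
    ≡⟨ Σ≤-antidiagonal-last b (λ j i → ballot j 0 * ballot i (suc k)) ⟨
  Σ≤ (suc b) (λ j → ballot j 0 * ballot (suc b ∸ j) (suc k)) ∎
  where
  S₁ S₂ last : ℕ
  S₁ = Σ≤ b (λ j → ballot j 0 * ballot (suc (b ∸ j)) k)
  S₂ = Σ≤ b (λ j → ballot j 0 * ballot (b ∸ j) (2 + k))
  last = ballot (suc b) 0 * ballot 0 k

-- The binomial coefficient n C (b − 1), read as 0 when b = 0.
choosePred : ℕ → ℕ → ℕ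
choosePred n zero    = 0
choosePred n (suc b) = n C b

pascal : ∀ n b → choosePred n b + n C b ≡ suc n C b
pascal n zero    = refl
pascal n (suc b) = nCk+nC[k+1]≡[n+1]C[k+1] n b

choose-sym : ∀ {n} a b → n ≡ a + b → n C a ≡ n C b
choose-sym {n} a b refl = trans (nCk≡nC[n∸k] (m≤m+n a b)) (cong (n C_) (m+n∸m≡n a b))

-- Reflection principle: ballot b k = C(2b+k, b) − C(2b+k, b−1).
ballot-closed : ∀ b k n → n ≡ b + b + k → ballot b k + choosePred n b ≡ n C b
ballot-closed zero    k       n       _  = refl
ballot-closed (suc b) zero    (suc m) n≡ = begin
  ballot b 1 + suc m C b                 ≡⟨ cong (ballot b 1 +_) (pascal m b) ⟨
  ballot b 1 + (choosePred m b + m C b)  ≡⟨ +-assoc (ballot b 1) _ _ ⟨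
  (ballot b 1 + choosePred m b) + m C b  ≡⟨ cong (_+ m C b) (ballot-closed b 1 m (trans m≡ (+-comm 1 (b + b)))) ⟩
  m C b + m C b                          ≡⟨ cong (m C b +_) (choose-sym (suc b) b m≡) ⟨
  m C b + m C suc b                      ≡⟨ nCk+nC[k+1]≡[n+1]C[k+1] m b ⟩
  suc m C suc b                          ∎
  where
  m≡ : m ≡ suc b + b
  m≡ = trans (suc-injective n≡) (arith b)
    where
    arith : ∀ b → b + suc b + 0 ≡ suc b + b
    arith = solve-∀
ballot-closed (suc b) (suc k) (suc m) n≡ = begin
  (X + Y) + suc m C b                 ≡⟨ cong ((X + Y) +_) (pascal m b) ⟨
  (X + Y) + (choosePred m b + m C b)  ≡⟨ cong ((X + Y) +_) (+-comm (choosePred m b) (m C b)) ⟩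
  (X + Y) + (m C b + choosePred m b)  ≡⟨ interchange X Y (m C b) (choosePred m b) ⟩
  (X + m C b) + (Y + choosePred m b)  ≡⟨ cong₂ _+_ (ballot-closed (suc b) k m m≡₁) (ballot-closed b (2 + k) m m≡₂) ⟩
  m C suc b + m C b                   ≡⟨ +-comm (m C suc b) (m C b) ⟩
  m C b + m C suc b                   ≡⟨ nCk+nC[k+1]≡[n+1]C[k+1] m b ⟩
  suc m C suc b                       ∎
  where
  X Y : ℕ
  X = ballot (suc b) k
  Y = ballot b (2 + k)
  arith₁ : ∀ b k → b + suc b + suc k ≡ suc b + suc b + k
  arith₁ = solve-∀
  arith₂ : ∀ b k → b + suc b + suc k ≡ b + b + (2 + k)
  arith₂ = solve-∀
  m≡₁ : m ≡ suc b + suc b + k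
  m≡₁ = trans (suc-injective n≡) (arith₁ b k)
  m≡₂ : m ≡ b + b + (2 + k)
  m≡₂ = trans (suc-injective n≡) (arith₂ b k)

absorption : ∀ m k → suc k * (suc m C suc k) ≡ suc m * (m C k)
absorption zero    zero    = refl
absorption zero    (suc k) = begin
  suc (suc k) * (1 C suc (suc k))  ≡⟨ cong (suc (suc k) *_) (k>n⇒nCk≡0 {1} {suc (suc k)} (s≤s (s≤s z≤n))) ⟩
  suc (suc k) * 0                  ≡⟨ *-zeroʳ (suc (suc k)) ⟩
  0                                ≡⟨ cong (1 *_) (k>n⇒nCk≡0 {0} {suc k} (s≤s z≤n)) ⟨
  1 * (0 C suc k)                  ∎
absorption (suc m) zero    = trans (*-identityˡ _) (trans (nC1≡n (suc (suc m))) (sym (*-identityʳ (suc (suc m)))))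
absorption (suc m) (suc k) = begin
  suc (suc k) * (suc (suc m) C suc (suc k))   ≡⟨ cong (suc (suc k) *_) (nCk+nC[k+1]≡[n+1]C[k+1] (suc m) (suc k)) ⟨
  suc (suc k) * (X + Y)                       ≡⟨ *-distribˡ-+ (suc (suc k)) X Y ⟩
  (X + suc k * X) + suc (suc k) * Y           ≡⟨ cong₂ (λ u v → (X + u) + v) (absorption m k) (absorption m (suc k)) ⟩
  (X + suc m * (m C k)) + suc m * (m C suc k) ≡⟨ +-assoc X _ _ ⟩
  X + (suc m * (m C k) + suc m * (m C suc k)) ≡⟨ cong (X +_) (*-distribˡ-+ (suc m) (m C k) (m C suc k)) ⟨
  X + suc m * (m C k + m C suc k)             ≡⟨ cong (λ z → X + suc m * z) (nCk+nC[k+1]≡[n+1]C[k+1] m k) ⟩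
  X + suc m * X                               ∎
  where
  X Y : ℕ
  X = suc m C suc k
  Y = suc m C suc (suc k)

central-ratio : ∀ c → suc (suc c) * ((suc c + suc c) C c) ≡ suc c * ((suc c + suc c) C suc c)
central-ratio c = begin
  suc (suc c) * (n C c)           ≡⟨ cong (suc (suc c) *_) (choose-sym c (suc (suc c)) (sym (+-suc c (suc c)))) ⟩
  suc (suc c) * (n C suc (suc c)) ≡⟨ absorption m (suc c) ⟩
  n * (m C suc c)                 ≡⟨ cong (n *_) (choose-sym (suc c) c (+-comm c (suc c))) ⟩
  n * (m C c)                     ≡⟨ absorption m c ⟨
  suc c * (n C suc c)             ∎
  where
  m n : ℕ
  m = c + suc c
  n = suc m

ballot-central : ∀ b → suc b * ballot b 0 ≡ (b + b) C b
ballot-central zero    = refl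
ballot-central (suc c) = +-cancelʳ-≡ (suc c * X) _ _ (begin
  suc (suc c) * g + suc c * X             ≡⟨ cong (suc (suc c) * g +_) (central-ratio c) ⟨
  suc (suc c) * g + suc (suc c) * (n C c) ≡⟨ *-distribˡ-+ (suc (suc c)) g (n C c) ⟨
  suc (suc c) * (g + n C c)               ≡⟨ cong (suc (suc c) *_) (ballot-closed (suc c) 0 n (sym (+-identityʳ n))) ⟩
  suc (suc c) * X                         ∎)
  where
  n g X : ℕ
  n = suc c + suc c
  g = ballot (suc c) 0
  X = n C suc c

Cat≡ballot : ∀ b → Cat b ≡ ballot b 0
Cat≡ballot b = begin
  ((b + (b + 0)) C b) / suc b  ≡⟨ cong (λ x → ((b + x) C b) / suc b) (+-identityʳ b) ⟩
  ((b + b) C b) / suc b        ≡⟨ cong (_/ suc b) (trans (*-comm (ballot b 0) (suc b)) (ballot-central b)) ⟨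
  (ballot b 0 * suc b) / suc b ≡⟨ m*n/n≡m (ballot b 0) (suc b) ⟩
  ballot b 0                   ∎

catalan-convolution : ∀ p → Cat (suc p) ≡ Σ≤ p (λ j → Cat j * Cat (p ∸ j))
catalan-convolution p = begin
  Cat (suc p)                                   ≡⟨ Cat≡ballot (suc p) ⟩
  ballot p 1                                    ≡⟨ ballot-convolution p 0 ⟩
  Σ≤ p (λ j → ballot j 0 * ballot (p ∸ j) 0)    ≡⟨ Σ≤-cong p (λ j → cong₂ _*_ (Cat≡ballot j) (Cat≡ballot (p ∸ j))) ⟨
  Σ≤ p (λ j → Cat j * Cat (p ∸ j))              ∎

sumOver : ∀ {X : Set} → (X → ℕ) → List X → ℕ
sumOver φ xs = sum (map φ xs)

module _ {X : Set} where

  sumOver-++ : ∀ (φ : X → ℕ) xs ys → sumOver φ (xs ++ ys) ≡ sumOver φ xs + sumOver φ ys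
  sumOver-++ φ xs ys = trans (cong sum (map-++ φ xs ys)) (sum-++ (map φ xs) (map φ ys))

  sumOver-+ : ∀ (φ ψ : X → ℕ) xs → sumOver (λ x → φ x + ψ x) xs ≡ sumOver φ xs + sumOver ψ xs
  sumOver-+ φ ψ []       = refl
  sumOver-+ φ ψ (x ∷ xs) = trans (cong (φ x + ψ x +_) (sumOver-+ φ ψ xs)) (interchange (φ x) (ψ x) _ _)

  sumOver-* : ∀ c (φ : X → ℕ) xs → sumOver (λ x → c * φ x) xs ≡ c * sumOver φ xs
  sumOver-* c φ []       = sym (*-zeroʳ c)
  sumOver-* c φ (x ∷ xs) = trans (cong (c * φ x +_) (sumOver-* c φ xs)) (sym (*-distribˡ-+ c (φ x) _))

  sumOver-const : ∀ c (xs : List X) → sumOver (λ _ → c) xs ≡ length xs * c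
  sumOver-const c []       = refl
  sumOver-const c (x ∷ xs) = cong (c +_) (sumOver-const c xs)

  sumOver-shiftq : ∀ m (f : X → ℕ → ℕ) i xs →
    sumOver (λ x → shiftq m (f x) i) xs ≡ shiftq m (λ j → sumOver (λ x → f x j) xs) i
  sumOver-shiftq m f i xs with m ≤ᵇ i
  ... | true  = refl
  ... | false = trans (sumOver-const 0 xs) (*-zeroʳ (length xs))

  sumOver-cong : ∀ {φ ψ : X → ℕ} → (∀ x → φ x ≡ ψ x) → ∀ xs → sumOver φ xs ≡ sumOver ψ xs
  sumOver-cong e xs = cong sum (map-cong e xs)

  sumOver-congᴬ : ∀ {φ ψ : X → ℕ} {xs} → All (λ x → φ x ≡ ψ x) xs → sumOver φ xs ≡ sumOver ψ xs
  sumOver-congᴬ e = cong sum (map-cong-local e)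

sumOver-map : ∀ {X Y : Set} (φ : Y → ℕ) (h : X → Y) xs → sumOver φ (map h xs) ≡ sumOver (λ x → φ (h x)) xs
sumOver-map φ h xs = cong sum (sym (map-∘ xs))

sumOver-concatMap : ∀ {X Y : Set} (φ : Y → ℕ) (g : X → List Y) xs →
  sumOver φ (concatMap g xs) ≡ sumOver (λ x → sumOver φ (g x)) xs
sumOver-concatMap φ g []       = refl
sumOver-concatMap φ g (x ∷ xs) =
  trans (sumOver-++ φ (g x) (concatMap g xs)) (cong (sumOver φ (g x) +_) (sumOver-concatMap φ g xs))

sumOver-applyUpTo : ∀ (f g : ℕ → ℕ) m → sumOver f (applyUpTo g (suc m)) ≡ Σ≤ m (λ k → f (g k))
sumOver-applyUpTo f g zero    = +-identityʳ _
sumOver-applyUpTo f g (suc m) =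
  trans (cong (f (g 0) +_) (sumOver-applyUpTo f (λ k → g (suc k)) m)) (sym (Σ≤-head m (λ k → f (g k))))

Forests : ℕ → List (List Tree)
Forests m = forestsF (suc m) m

forestsF-fuel : ∀ f g m → m < f → m < g → forestsF f m ≡ forestsF g m
forestsF-fuel (suc f) (suc g) zero    _         _         = refl
forestsF-fuel (suc f) (suc g) (suc m) (s≤s m<f) (s≤s m<g) =
  cong concat (map-cong-local (applyUpTo⁺₁ (λ k → k) (suc m) λ {k} k<sm →
    cong₂ (λ rests firsts → concatMap (λ ts → map (λ rest → node ts ∷ rest) rests) firsts)
      (forestsF-fuel f g (m ∸ k) (≤-<-trans (m∸n≤m m k) m<f) (≤-<-trans (m∸n≤m m k) m<g))
      (forestsF-fuel f g k (≤-<-trans (≤-pred k<sm) m<f) (≤-<-trans (≤-pred k<sm) m<g))))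

forest-size : ∀ f m → All (λ ts → verticesF ts ≡ m) (forestsF f m)
forest-size zero    m       = []
forest-size (suc f) zero    = refl ∷ []
forest-size (suc f) (suc m) = concat⁺ (map⁺ (applyUpTo⁺₁ (λ k → k) (suc m) λ {k} k<sm →
  concat⁺ (map⁺ (All.map (λ {ts} e → map⁺ (All.map (λ {rest} e′ → size-∷ ts rest (≤-pred k<sm) e e′)
                                                    (forest-size f (m ∸ k))))
                        (forest-size f k)))))
  where
  size-∷ : ∀ {k} ts rest → k ≤ m → verticesF ts ≡ k → verticesF rest ≡ m ∸ k → verticesF (node ts ∷ rest) ≡ suc m
  size-∷ ts rest k≤m e e′ = cong suc (trans (cong₂ _+_ e e′) (m+[n∸m]≡n k≤m))

sumOver-forests-suc : ∀ p (φ : List Tree → ℕ) →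
  sumOver φ (Forests (suc p))
    ≡ Σ≤ p (λ k → sumOver (λ ts → sumOver (λ rest → φ (node ts ∷ rest)) (Forests (p ∸ k))) (Forests k))
sumOver-forests-suc p φ = begin
  sumOver φ (concatMap pieces (upTo (suc p)))        ≡⟨ sumOver-concatMap φ pieces (upTo (suc p)) ⟩
  sumOver (λ k → sumOver φ (pieces k)) (upTo (suc p)) ≡⟨ sumOver-applyUpTo (λ k → sumOver φ (pieces k)) (λ k → k) p ⟩
  Σ≤ p (λ k → sumOver φ (pieces k))                  ≡⟨ Σ≤-cong≤ p piece-sum ⟩
  Σ≤ p (λ k → sumOver (λ ts → sumOver (λ rest → φ (node ts ∷ rest)) (Forests (p ∸ k))) (Forests k)) ∎
  where
  pieces : ℕ → List (List Tree)
  pieces k = concatMap (λ ts → map (λ rest → node ts ∷ rest) (forestsF (suc p) (p ∸ k))) (forestsF (suc p) k)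
  piece-sum : ∀ k → k ≤ p →
    sumOver φ (pieces k) ≡ sumOver (λ ts → sumOver (λ rest → φ (node ts ∷ rest)) (Forests (p ∸ k))) (Forests k)
  piece-sum k k≤p = begin
    sumOver φ (pieces k)
      ≡⟨ sumOver-concatMap φ _ (forestsF (suc p) k) ⟩
    sumOver (λ ts → sumOver φ (map (λ rest → node ts ∷ rest) (forestsF (suc p) (p ∸ k)))) (forestsF (suc p) k)
      ≡⟨ sumOver-cong (λ ts → sumOver-map φ (λ rest → node ts ∷ rest) (forestsF (suc p) (p ∸ k))) (forestsF (suc p) k) ⟩
    sumOver (λ ts → sumOver (λ rest → φ (node ts ∷ rest)) (forestsF (suc p) (p ∸ k))) (forestsF (suc p) k)
      ≡⟨ cong₂ (λ rests firsts → sumOver (λ ts → sumOver (λ rest → φ (node ts ∷ rest)) rests) firsts)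
               (forestsF-fuel (suc p) (suc (p ∸ k)) (p ∸ k) (s≤s (m∸n≤m p k)) ≤-refl)
               (forestsF-fuel (suc p) (suc k) k (s≤s k≤p) ≤-refl) ⟩
    sumOver (λ ts → sumOver (λ rest → φ (node ts ∷ rest)) (Forests (p ∸ k))) (Forests k) ∎

forest-count : ∀ m → length (Forests m) ≡ Cat m
forest-count m = bounded m m ≤-refl
  where
  count-as-sum : ∀ {X : Set} (xs : List X) → length xs ≡ sumOver (λ _ → 1) xs
  count-as-sum xs = sym (trans (sumOver-const 1 xs) (*-identityʳ _))
  bounded : ∀ n m → m ≤ n → length (Forests m) ≡ Cat m
  bounded n       zero    _         = refl
  bounded (suc n) (suc p) (s≤s p≤n) = begin
    length (Forests (suc p))                ≡⟨ count-as-sum (Forests (suc p)) ⟩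
    sumOver (λ _ → 1) (Forests (suc p))     ≡⟨ sumOver-forests-suc p (λ _ → 1) ⟩
    Σ≤ p (λ k → sumOver (λ _ → sumOver (λ _ → 1) (Forests (p ∸ k))) (Forests k))
      ≡⟨ Σ≤-cong≤ p pairs ⟩
    Σ≤ p (λ k → Cat k * Cat (p ∸ k))        ≡⟨ catalan-convolution p ⟨
    Cat (suc p)                             ∎
    where
    pairs : ∀ k → k ≤ p → sumOver (λ _ → sumOver (λ _ → 1) (Forests (p ∸ k))) (Forests k) ≡ Cat k * Cat (p ∸ k)
    pairs k k≤p = begin
      sumOver (λ _ → sumOver (λ _ → 1) (Forests (p ∸ k))) (Forests k)
        ≡⟨ sumOver-const _ (Forests k) ⟩
      length (Forests k) * sumOver (λ _ → 1) (Forests (p ∸ k))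
        ≡⟨ cong (length (Forests k) *_) (count-as-sum (Forests (p ∸ k))) ⟨
      length (Forests k) * length (Forests (p ∸ k))
        ≡⟨ cong₂ _*_ (bounded n k (≤-trans k≤p p≤n)) (bounded n (p ∸ k) (≤-trans (m∸n≤m p k) p≤n)) ⟩
      Cat k * Cat (p ∸ k) ∎

sumOver-forests-const : ∀ m c → sumOver (λ _ → c) (Forests m) ≡ Cat m * c
sumOver-forests-const m c = trans (sumOver-const c (Forests m)) (cong (_* c) (forest-count m))

-- A_n(q) as a sum over forests: a tree with n edges is a root over a forest with n vertices.
A-as-forest-sum : ∀ n i → A n i ≡ sumOver (λ ts → Av (node ts) i) (Forests n)
A-as-forest-sum n i = sumOver-map (λ T → Av T i) node (Forests n)

count-∷ : ∀ j x xs → count j (x ∷ xs) ≡ qpow x j + count j xs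
count-∷ j x xs with x ≡ᵇ j
... | true  = refl
... | false = refl

count-++ : ∀ j xs ys → count j (xs ++ ys) ≡ count j xs + count j ys
count-++ j xs ys = trans (cong length (filter-++ (_≟ j) xs ys)) (length-++ (filter (_≟ j) xs))

shiftq-suc : ∀ m (P : ℕ → ℕ) j → shiftq (suc m) P (suc j) ≡ shiftq m P j
shiftq-suc zero    P j = refl
shiftq-suc (suc m) P j = refl

shiftq-cong : ∀ m {P Q : ℕ → ℕ} → (∀ j → P j ≡ Q j) → ∀ i → shiftq m P i ≡ shiftq m Q i
shiftq-cong m e i = cong (λ x → if m ≤ᵇ i then x else 0) (e (i ∸ m))

shiftq-+ : ∀ m (P Q : ℕ → ℕ) i → shiftq m (λ j → P j + Q j) i ≡ shiftq m P i + shiftq m Q i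
shiftq-+ m P Q i with m ≤ᵇ i
... | true  = refl
... | false = refl

shiftq-zero : ∀ m i → shiftq m (λ _ → 0) i ≡ 0
shiftq-zero m i with m ≤ᵇ i
... | true  = refl
... | false = refl

shiftq-qpow : ∀ c x j → shiftq c (qpow x) j ≡ qpow (c + x) j
shiftq-qpow zero    x j       = refl
shiftq-qpow (suc c) x zero    = refl
shiftq-qpow (suc c) x (suc j) = trans (shiftq-suc c (qpow x) j) (shiftq-qpow c x j)

count-map-shift : ∀ c j xs → count j (map (c +_) xs) ≡ shiftq c (λ d → count d xs) j
count-map-shift c j []       = sym (shiftq-zero c j)
count-map-shift c j (x ∷ xs) = begin
  count j ((c + x) ∷ map (c +_) xs)                          ≡⟨ count-∷ j (c + x) _ ⟩
  qpow (c + x) j + count j (map (c +_) xs)                   ≡⟨ cong₂ _+_ (sym (shiftq-qpow c x j)) (count-map-shift c j xs) ⟩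
  shiftq c (qpow x) j + shiftq c (λ d → count d xs) j        ≡⟨ shiftq-+ c (qpow x) (λ d → count d xs) j ⟨
  shiftq c (λ d → qpow x d + count d xs) j                   ≡⟨ shiftq-cong c (λ d → count-∷ d x xs) j ⟨
  shiftq c (λ d → count d (x ∷ xs)) j                        ∎

mutual
  labels-shift : ∀ μ ν t → labels (μ + ν) t ≡ map (μ +_) (labels ν t)
  labels-shift μ ν (node ts) = cong ((μ + ν) ∷_) (labelsChildren-shift μ ν ts)

  labelsChildren-shift : ∀ μ ν ts → labelsChildren (μ + ν) ts ≡ map (μ +_) (labelsChildren ν ts)
  labelsChildren-shift μ ν []       = refl
  labelsChildren-shift μ ν (t ∷ ts) = begin
    labels (μ + ν + vertices t) t ++ labelsChildren (μ + ν) ts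
      ≡⟨ cong₂ _++_ (trans (cong (λ x → labels x t) (+-assoc μ ν (vertices t))) (labels-shift μ (ν + vertices t) t))
                    (labelsChildren-shift μ ν ts) ⟩
    map (μ +_) (labels (ν + vertices t) t) ++ map (μ +_) (labelsChildren ν ts)
      ≡⟨ map-++ (μ +_) (labels (ν + vertices t) t) (labelsChildren ν ts) ⟨
    map (μ +_) (labels (ν + vertices t) t ++ labelsChildren ν ts) ∎

labels-from : ∀ μ t → labels μ t ≡ map (μ +_) (labels 0 t)
labels-from μ t = trans (cong (λ x → labels x t) (sym (+-identityʳ μ))) (labels-shift μ 0 t)

labelsChildren-from : ∀ μ ts → labelsChildren μ ts ≡ map (μ +_) (labelsChildren 0 ts)
labelsChildren-from μ ts = trans (cong (λ x → labelsChildren x ts) (sym (+-identityʳ μ))) (labelsChildren-shift μ 0 ts)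

-- Only the root is labelled 0: every child is labelled above its parent.
count-children-0 : ∀ ts → count 0 (labelsChildren 0 ts) ≡ 0
count-children-0 []              = refl
count-children-0 (node us ∷ ts) = begin
  count 0 (labels v (node us) ++ labelsChildren 0 ts)
    ≡⟨ count-++ 0 (labels v (node us)) _ ⟩
  count 0 (labels v (node us)) + count 0 (labelsChildren 0 ts)
    ≡⟨ cong₂ _+_ (trans (cong (count 0) (labels-from v (node us))) (count-map-shift v 0 (labels 0 (node us))))
                 (count-children-0 ts) ⟩
  0 ∎
  where
  v : ℕ
  v = vertices (node us)

Av-children : ∀ ts d → count d (labelsChildren 0 ts) ≡ Av (node ts) d
Av-children ts zero    = count-children-0 ts
Av-children ts (suc d) = refl

count-labels : ∀ μ ts j → count j (labels μ (node ts)) ≡ qpow μ j + shiftq μ (Av (node ts)) j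
count-labels μ ts j = begin
  count j (μ ∷ labelsChildren μ ts)                         ≡⟨ count-∷ j μ _ ⟩
  qpow μ j + count j (labelsChildren μ ts)                  ≡⟨ cong (λ xs → qpow μ j + count j xs) (labelsChildren-from μ ts) ⟩
  qpow μ j + count j (map (μ +_) (labelsChildren 0 ts))     ≡⟨ cong (qpow μ j +_) (count-map-shift μ j (labelsChildren 0 ts)) ⟩
  qpow μ j + shiftq μ (λ d → count d (labelsChildren 0 ts)) j ≡⟨ cong (qpow μ j +_) (shiftq-cong μ (Av-children ts) j) ⟩
  qpow μ j + shiftq μ (Av (node ts)) j                      ∎

Av-first-tree : ∀ ts rest i → Av (node (node ts ∷ rest)) i
  ≡ qpow (suc (verticesF ts)) i + shiftq (suc (verticesF ts)) (Av (node ts)) i + Av (node rest) i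
Av-first-tree ts rest zero    = refl
Av-first-tree ts rest (suc i) = begin
  count (suc i) (labels v (node ts) ++ labelsChildren 0 rest)
    ≡⟨ count-++ (suc i) (labels v (node ts)) _ ⟩
  count (suc i) (labels v (node ts)) + count (suc i) (labelsChildren 0 rest)
    ≡⟨ cong (_+ Av (node rest) (suc i)) (count-labels v ts (suc i)) ⟩
  qpow v (suc i) + shiftq v (Av (node ts)) (suc i) + Av (node rest) (suc i) ∎
  where
  v : ℕ
  v = suc (verticesF ts)

first-tree-sum : ∀ m i →
  sumOver (λ ts → qpow (suc m) i + shiftq (suc m) (Av (node ts)) i) (Forests m)
    ≡ Cat m * qpow (suc m) i + shiftq (suc m) (A m) i
first-tree-sum m i = begin
  sumOver (λ ts → qpow (suc m) i + shiftq (suc m) (Av (node ts)) i) (Forests m)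
    ≡⟨ sumOver-+ (λ _ → qpow (suc m) i) (λ ts → shiftq (suc m) (Av (node ts)) i) (Forests m) ⟩
  sumOver (λ _ → qpow (suc m) i) (Forests m) + sumOver (λ ts → shiftq (suc m) (Av (node ts)) i) (Forests m)
    ≡⟨ cong₂ _+_ (sumOver-forests-const m (qpow (suc m) i)) (sumOver-shiftq (suc m) (λ ts → Av (node ts)) i (Forests m)) ⟩
  Cat m * qpow (suc m) i + shiftq (suc m) (λ j → sumOver (λ ts → Av (node ts) j) (Forests m)) i
    ≡⟨ cong (Cat m * qpow (suc m) i +_) (shiftq-cong (suc m) (λ j → A-as-forest-sum m j) i) ⟨
  Cat m * qpow (suc m) i + shiftq (suc m) (A m) i ∎

pair-contribution : ∀ m n i →
  sumOver (λ ts → sumOver (λ rest → Av (node (node ts ∷ rest)) i) (Forests n)) (Forests m)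
    ≡ Cat m * Cat n * qpow (suc m) i + Cat n * shiftq (suc m) (A m) i + Cat m * A n i
pair-contribution m n i = begin
  sumOver (λ ts → sumOver (λ rest → Av (node (node ts ∷ rest)) i) R) L
    ≡⟨ sumOver-congᴬ (All.map (λ {ts} size → sumOver-cong (λ rest → split ts rest size) R) (forest-size (suc m) m)) ⟩
  sumOver (λ ts → sumOver (λ rest → a ts + Av (node rest) i) R) L
    ≡⟨ sumOver-cong inner L ⟩
  sumOver (λ ts → Cat n * a ts + A n i) L
    ≡⟨ sumOver-+ (λ ts → Cat n * a ts) (λ _ → A n i) L ⟩
  sumOver (λ ts → Cat n * a ts) L + sumOver (λ _ → A n i) L
    ≡⟨ cong₂ _+_ (sumOver-* (Cat n) a L) (sumOver-forests-const m (A n i)) ⟩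
  Cat n * sumOver a L + Cat m * A n i
    ≡⟨ cong (λ x → Cat n * x + Cat m * A n i) (first-tree-sum m i) ⟩
  Cat n * (Cat m * qpow (suc m) i + shiftq (suc m) (A m) i) + Cat m * A n i
    ≡⟨ arith (Cat n) (Cat m) (qpow (suc m) i) (shiftq (suc m) (A m) i) (A n i) ⟩
  Cat m * Cat n * qpow (suc m) i + Cat n * shiftq (suc m) (A m) i + Cat m * A n i ∎
  where
  L R : List (List Tree)
  L = Forests m
  R = Forests n
  a : List Tree → ℕ
  a ts = qpow (suc m) i + shiftq (suc m) (Av (node ts)) i
  split : ∀ ts rest → verticesF ts ≡ m → Av (node (node ts ∷ rest)) i ≡ a ts + Av (node rest) i
  split ts rest size =
    subst (λ k → Av (node (node ts ∷ rest)) i ≡ qpow (suc k) i + shiftq (suc k) (Av (node ts)) i + Av (node rest) i)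
          size (Av-first-tree ts rest i)
  inner : ∀ ts → sumOver (λ rest → a ts + Av (node rest) i) R ≡ Cat n * a ts + A n i
  inner ts = trans (sumOver-+ (λ _ → a ts) (λ rest → Av (node rest) i) R)
                   (cong₂ _+_ (sumOver-forests-const n (a ts)) (sym (A-as-forest-sum n i)))
  arith : ∀ c d x y z → c * (d * x + y) + d * z ≡ d * c * x + c * y + d * z
  arith = solve-∀

avalanche-recurrence : ∀ p i → A (suc p) i
  ≡ Σ≤ p (λ k → Cat k * Cat (p ∸ k) * qpow (suc k) i + Cat (p ∸ k) * shiftq (suc k) (A k) i + Cat k * A (p ∸ k) i)
avalanche-recurrence p i = begin
  A (suc p) i                                         ≡⟨ A-as-forest-sum (suc p) i ⟩
  sumOver (λ ts → Av (node ts) i) (Forests (suc p))   ≡⟨ sumOver-forests-suc p (λ ts → Av (node ts) i) ⟩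
  Σ≤ p (λ k → sumOver (λ ts → sumOver (λ rest → Av (node (node ts ∷ rest)) i) (Forests (p ∸ k))) (Forests k))
    ≡⟨ Σ≤-cong p (λ k → pair-contribution k (p ∸ k) i) ⟩
  Σ≤ p (λ k → Cat k * Cat (p ∸ k) * qpow (suc k) i + Cat (p ∸ k) * shiftq (suc k) (A k) i + Cat k * A (p ∸ k) i) ∎

-- Formal power series in t and q with natural coefficients: F p i is the
-- coefficient of t^p q^i.
NSeries : Set
NSeries = ℕ → ℕ → ℕ

infix  4 _≈ₙ_
infixr 5 _▸_
infixl 6 _⊕ₙ_
infixl 7 _⊗ₙ_ _·ₙ_

_≈ₙ_ : NSeries → NSeries → Set
F ≈ₙ G = ∀ p i → F p i ≡ G p i

_▸_ : ∀ {F G H : NSeries} → F ≈ₙ G → G ≈ₙ H → F ≈ₙ H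
(e₁ ▸ e₂) p i = trans (e₁ p i) (e₂ p i)

_⊗ₙ_ : NSeries → NSeries → NSeries
(F ⊗ₙ G) p i = Σ≤ p (λ a → Σ≤ i (λ b → F a b * G (p ∸ a) (i ∸ b)))

_⊕ₙ_ : NSeries → NSeries → NSeries
(F ⊕ₙ G) p i = F p i + G p i

_·ₙ_ : ℕ → NSeries → NSeries
(c ·ₙ F) p i = c * F p i

embₙ : (ℕ → ℕ) → NSeries
embₙ e p zero    = e p
embₙ e p (suc i) = 0

𝟙ₙ : NSeries
𝟙ₙ = embₙ (λ { zero → 1 ; (suc _) → 0 })

tS : NSeries → NSeries
tS F zero    i = 0
tS F (suc p) i = F p i

qS : NSeries → NSeries
qS F p zero    = 0
qS F p (suc i) = F p i

-- The substitution F(t, q) ↦ F(qt, q).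
substₙ : NSeries → NSeries
substₙ F p i = shiftq p (F p) i

·ₙ-cong : ∀ c {F F′} → F ≈ₙ F′ → c ·ₙ F ≈ₙ c ·ₙ F′
·ₙ-cong c e p i = cong (c *_) (e p i)

tS-cong : ∀ {F F′} → F ≈ₙ F′ → tS F ≈ₙ tS F′
tS-cong e zero    i = refl
tS-cong e (suc p) i = e p i

qS-cong : ∀ {F F′} → F ≈ₙ F′ → qS F ≈ₙ qS F′
qS-cong e p zero    = refl
qS-cong e p (suc i) = e p i

⊗ₙ-scal : ∀ c F G → (c ·ₙ F) ⊗ₙ G ≈ₙ c ·ₙ (F ⊗ₙ G)
⊗ₙ-scal c F G p i =
  trans (Σ≤-cong p (λ a → trans (Σ≤-cong i (λ b → *-assoc c (F a b) (G (p ∸ a) (i ∸ b)))) (Σ≤-* i c _)))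
        (Σ≤-* p c _)

⊗ₙ-tS : ∀ F G → tS F ⊗ₙ G ≈ₙ tS (F ⊗ₙ G)
⊗ₙ-tS F G zero    i = Σ≤-zero i
⊗ₙ-tS F G (suc p) i = trans (Σ≤-head p _) (cong (_+ (F ⊗ₙ G) p i) (Σ≤-zero i))

⊗ₙ-qS : ∀ F G → qS F ⊗ₙ G ≈ₙ qS (F ⊗ₙ G)
⊗ₙ-qS F G p zero    = Σ≤-zero p
⊗ₙ-qS F G p (suc i) = Σ≤-cong p (λ a → Σ≤-head i (λ b → qS F a b * G (p ∸ a) (suc i ∸ b)))

⊗ₙ-scaled-t : ∀ c F G → (c ·ₙ tS F) ⊗ₙ G ≈ₙ c ·ₙ tS (F ⊗ₙ G)
⊗ₙ-scaled-t c F G = ⊗ₙ-scal c (tS F) G ▸ ·ₙ-cong c (⊗ₙ-tS F G)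

⊗ₙ-scaled-qt : ∀ c F G → (c ·ₙ qS (tS F)) ⊗ₙ G ≈ₙ c ·ₙ qS (tS (F ⊗ₙ G))
⊗ₙ-scaled-qt c F G = ⊗ₙ-scal c (qS (tS F)) G ▸ ·ₙ-cong c (⊗ₙ-qS (tS F) G ▸ qS-cong (⊗ₙ-tS F G))

emb-conv : ∀ e G p i → (embₙ e ⊗ₙ G) p i ≡ Σ≤ p (λ a → e a * G (p ∸ a) i)
emb-conv e G p i = Σ≤-cong p (λ a → Σ≤-first i _ (λ b → refl))

⊗ₙ-one : ∀ G → 𝟙ₙ ⊗ₙ G ≈ₙ G
⊗ₙ-one G p i = trans (emb-conv _ G p i) (trans (Σ≤-first p _ (λ a → refl)) (+-identityʳ (G p i)))

subst-emb : ∀ e m i → substₙ (embₙ e) m i ≡ qpow m i * e m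
subst-emb e m i = shift-emb m i
  where
  shift-emb : ∀ k i → shiftq k (embₙ e m) i ≡ qpow k i * e m
  shift-emb zero    zero    = sym (+-identityʳ (e m))
  shift-emb zero    (suc i) = refl
  shift-emb (suc k) zero    = refl
  shift-emb (suc k) (suc i) = trans (shiftq-suc k (embₙ e m) i) (shift-emb k i)

-- The series 1 − √(1 − 4t) = Σ_n 2 Cat n t^(n+1).
U : ℕ → ℕ
U zero    = 0
U (suc n) = 2 * Cat n

Useries : NSeries
Useries = embₙ U

-- Products with U: U has no constant term and U_(a+1) = 2 Cat a.
Useries-conv-zero : ∀ G i → (Useries ⊗ₙ G) 0 i ≡ 0
Useries-conv-zero G i = emb-conv U G 0 i

Useries-conv : ∀ G p i → (Useries ⊗ₙ G) (suc p) i ≡ 2 * Σ≤ p (λ a → Cat a * G (p ∸ a) i)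
Useries-conv G p i = begin
  (Useries ⊗ₙ G) (suc p) i                   ≡⟨ emb-conv U G (suc p) i ⟩
  Σ≤ (suc p) (λ a → U a * G (suc p ∸ a) i)   ≡⟨ Σ≤-head p _ ⟩
  Σ≤ p (λ a → 2 * Cat a * G (p ∸ a) i)       ≡⟨ Σ≤-cong p (λ a → *-assoc 2 (Cat a) _) ⟩
  Σ≤ p (λ a → 2 * (Cat a * G (p ∸ a) i))     ≡⟨ Σ≤-* p 2 _ ⟩
  2 * Σ≤ p (λ a → Cat a * G (p ∸ a) i)       ∎

subst-Useries-zero : ∀ i → substₙ Useries 0 i ≡ 0
subst-Useries-zero i = trans (subst-emb U 0 i) (*-zeroʳ (qpow 0 i))

-- The three sums of the recurrence for A_{P+1}, multiplied by 4, are the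
-- coefficients of t^(P+2) in U(t)U(qt), 2qt U(t)A(qt) and 2t U(t)A(t).
root-term : ∀ P i → 4 * Σ≤ P (λ k → Cat k * Cat (P ∸ k) * qpow (suc k) i) ≡ (Useries ⊗ₙ substₙ Useries) (2 + P) i
root-term P i = begin
  4 * Σ≤ P (λ k → Cat k * Cat (P ∸ k) * qpow (suc k) i)
    ≡⟨ cong (4 *_) (Σ≤-cong P (λ k → arith₁ (Cat k) (Cat (P ∸ k)) _)) ⟩
  4 * Σ≤ P (λ k → h (P ∸ k) k)
    ≡⟨ cong (4 *_) (Σ≤-reflect P h) ⟨
  4 * Σ≤ P (λ k → h k (P ∸ k))
    ≡⟨ *-assoc 2 2 (Σ≤ P (λ k → h k (P ∸ k))) ⟩
  2 * (2 * Σ≤ P (λ k → h k (P ∸ k)))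
    ≡⟨ cong (2 *_) (Σ≤-* P 2 _) ⟨
  2 * Σ≤ P (λ k → 2 * h k (P ∸ k))
    ≡⟨ cong (2 *_) (Σ≤-cong P (λ k → arith₂ (Cat k) (Cat (P ∸ k)) _)) ⟩
  2 * Σ≤ P (λ k → Cat k * (qpow (suc (P ∸ k)) i * U (suc (P ∸ k))))
    ≡⟨ cong (2 *_) (+-identityʳ (Σ≤ P (λ k → Cat k * (qpow (suc (P ∸ k)) i * U (suc (P ∸ k)))))) ⟨
  2 * (Σ≤ P (λ k → Cat k * (qpow (suc (P ∸ k)) i * U (suc (P ∸ k)))) + 0)
    ≡⟨ cong (2 *_) (cong₂ _+_ (Σ≤-cong P (λ k → cong (Cat k *_) (subst-emb U (suc (P ∸ k)) i)))
                              (trans (cong (Cat (suc P) *_) (subst-Useries-zero i)) (*-zeroʳ (Cat (suc P))))) ⟨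
  2 * (Σ≤ P (λ k → Cat k * substₙ Useries (suc (P ∸ k)) i) + Cat (suc P) * substₙ Useries 0 i)
    ≡⟨ cong (2 *_) (Σ≤-antidiagonal-last P (λ k j → Cat k * substₙ Useries j i)) ⟨
  2 * Σ≤ (suc P) (λ k → Cat k * substₙ Useries (suc P ∸ k) i)
    ≡⟨ Useries-conv (substₙ Useries) (suc P) i ⟨
  (Useries ⊗ₙ substₙ Useries) (2 + P) i ∎
  where
  h : ℕ → ℕ → ℕ
  h a b = Cat a * (Cat b * qpow (suc b) i)
  arith₁ : ∀ x y z → x * y * z ≡ y * (x * z)
  arith₁ = solve-∀
  arith₂ : ∀ x y z → 2 * (x * (y * z)) ≡ x * (z * (2 * y))
  arith₂ = solve-∀

shifted-term : ∀ P i → 4 * Σ≤ P (λ k → Cat (P ∸ k) * shiftq (suc k) (A k) i)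
                     ≡ 2 * qS (tS (Useries ⊗ₙ substₙ A)) (2 + P) i
shifted-term P zero    = cong (4 *_) (trans (Σ≤-cong P (λ k → *-zeroʳ (Cat (P ∸ k)))) (Σ≤-zero P))
shifted-term P (suc j) = begin
  4 * Σ≤ P (λ k → Cat (P ∸ k) * shiftq (suc k) (A k) (suc j))
    ≡⟨ cong (4 *_) (Σ≤-cong P (λ k → cong (Cat (P ∸ k) *_) (shiftq-suc k (A k) j))) ⟩
  4 * Σ≤ P (λ k → Cat (P ∸ k) * substₙ A k j)
    ≡⟨ cong (4 *_) (Σ≤-reflect P (λ a b → Cat a * substₙ A b j)) ⟨
  4 * Σ≤ P (λ k → Cat k * substₙ A (P ∸ k) j)
    ≡⟨ *-assoc 2 2 (Σ≤ P (λ k → Cat k * substₙ A (P ∸ k) j)) ⟩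
  2 * (2 * Σ≤ P (λ k → Cat k * substₙ A (P ∸ k) j))
    ≡⟨ cong (2 *_) (Useries-conv (substₙ A) P j) ⟨
  2 * (Useries ⊗ₙ substₙ A) (suc P) j ∎

rest-term : ∀ P i → 4 * Σ≤ P (λ k → Cat k * A (P ∸ k) i) ≡ 2 * tS (Useries ⊗ₙ A) (2 + P) i
rest-term P i = trans (*-assoc 2 2 (Σ≤ P (λ k → Cat k * A (P ∸ k) i))) (sym (cong (2 *_) (Useries-conv A P i)))

-- The single tree with no edges has no positive labels.
A₀ : ∀ i → A 0 i ≡ 0
A₀ zero    = refl
A₀ (suc i) = refl

generating-identityₙ : 4 ·ₙ tS A
  ≈ₙ Useries ⊗ₙ substₙ Useries ⊕ₙ 2 ·ₙ qS (tS (Useries ⊗ₙ substₙ A)) ⊕ₙ 2 ·ₙ tS (Useries ⊗ₙ A)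
generating-identityₙ zero i = sym (cong₂ _+_ (cong₂ _+_ (Useries-conv-zero (substₙ Useries) i) (no-qt-term i)) refl)
  where
  no-qt-term : ∀ i → 2 * qS (tS (Useries ⊗ₙ substₙ A)) 0 i ≡ 0
  no-qt-term zero    = refl
  no-qt-term (suc i) = refl
generating-identityₙ (suc zero) i = begin
  4 * A 0 i ≡⟨ cong (4 *_) (A₀ i) ⟩
  0         ≡⟨ cong₂ _+_ (cong₂ _+_ root (shifted i)) (cong (2 *_) (Useries-conv-zero A i)) ⟨
  (Useries ⊗ₙ substₙ Useries) 1 i + 2 * qS (tS (Useries ⊗ₙ substₙ A)) 1 i + 2 * (Useries ⊗ₙ A) 0 i ∎
  where
  root : (Useries ⊗ₙ substₙ Useries) 1 i ≡ 0
  root = trans (Useries-conv (substₙ Useries) 0 i) (cong (λ x → 2 * (1 * x)) (subst-Useries-zero i))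
  shifted : ∀ i → 2 * qS (tS (Useries ⊗ₙ substₙ A)) 1 i ≡ 0
  shifted zero    = refl
  shifted (suc j) = cong (2 *_) (Useries-conv-zero (substₙ A) j)
generating-identityₙ (suc (suc P)) i = begin
  4 * A (suc P) i                                ≡⟨ cong (4 *_) (avalanche-recurrence P i) ⟩
  4 * Σ≤ P (λ k → t₁ k + t₂ k + t₃ k)
    ≡⟨ cong (4 *_) (trans (Σ≤-+ P _ t₃) (cong (_+ Σ≤ P t₃) (Σ≤-+ P t₁ t₂))) ⟩
  4 * (Σ≤ P t₁ + Σ≤ P t₂ + Σ≤ P t₃)
    ≡⟨ distrib (Σ≤ P t₁) (Σ≤ P t₂) (Σ≤ P t₃) ⟩
  4 * Σ≤ P t₁ + 4 * Σ≤ P t₂ + 4 * Σ≤ P t₃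
    ≡⟨ cong₂ _+_ (cong₂ _+_ (root-term P i) (shifted-term P i)) (rest-term P i) ⟩
  (Useries ⊗ₙ substₙ Useries) (2 + P) i + 2 * qS (tS (Useries ⊗ₙ substₙ A)) (2 + P) i + 2 * tS (Useries ⊗ₙ A) (2 + P) i ∎
  where
  t₁ t₂ t₃ : ℕ → ℕ
  t₁ k = Cat k * Cat (P ∸ k) * qpow (suc k) i
  t₂ k = Cat (P ∸ k) * shiftq (suc k) (A k) i
  t₃ k = Cat k * A (P ∸ k) i
  distrib : ∀ x y z → 4 * (x + y + z) ≡ 4 * x + 4 * y + 4 * z
  distrib = solve-∀

-- The remaining part works with integer series.  The prefix +_ of ℤ is only
-- opened here, as it makes the sections (x +_) on ℕ used above ambiguous.
open import Data.Nat.Induction using (<-rec)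
open import Data.Integer as ℤ using (ℤ; +_)
import Data.Integer.Properties as ℤP
import Data.Integer.Tactic.RingSolver as ℤ-Ring
open import Data.Product using (_×_; _,_)

Σ≤ℤ-cong≤ : ∀ n {f g : ℕ → ℤ} → (∀ k → k ≤ n → f k ≡ g k) → Σ≤ℤ n f ≡ Σ≤ℤ n g
Σ≤ℤ-cong≤ zero    e = e 0 z≤n
Σ≤ℤ-cong≤ (suc n) e = cong₂ ℤ._+_ (Σ≤ℤ-cong≤ n (λ k k≤n → e k (m≤n⇒m≤1+n k≤n))) (e (suc n) ≤-refl)

Σ≤ℤ-cong : ∀ n {f g : ℕ → ℤ} → (∀ k → f k ≡ g k) → Σ≤ℤ n f ≡ Σ≤ℤ n g
Σ≤ℤ-cong n e = Σ≤ℤ-cong≤ n (λ k _ → e k)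

Σ≤ℤ-head : ∀ n (f : ℕ → ℤ) → Σ≤ℤ (suc n) f ≡ f 0 ℤ.+ Σ≤ℤ n (λ k → f (suc k))
Σ≤ℤ-head zero    f = refl
Σ≤ℤ-head (suc n) f = trans (cong (ℤ._+ f (suc (suc n))) (Σ≤ℤ-head n f)) (ℤP.+-assoc (f 0) _ _)

Σ≤ℤ-pos : ∀ n (f : ℕ → ℕ) → Σ≤ℤ n (λ k → + f k) ≡ + Σ≤ n f
Σ≤ℤ-pos zero    f = refl
Σ≤ℤ-pos (suc n) f = trans (cong (ℤ._+ + f (suc n)) (Σ≤ℤ-pos n f)) (sym (ℤP.pos-+ (Σ≤ n f) (f (suc n))))

infixr 5 _▹_

_▹_ : ∀ {F G H : Series} → F ≈ₛ G → G ≈ₛ H → F ≈ₛ H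
(e₁ ▹ e₂) p i = trans (e₁ p i) (e₂ p i)

≈ₛ-refl : ∀ {F : Series} → F ≈ₛ F
≈ₛ-refl p i = refl

≈ₛ-sym : ∀ {F G : Series} → F ≈ₛ G → G ≈ₛ F
≈ₛ-sym e p i = sym (e p i)

⊗-cong : ∀ {F F′ G G′} → F ≈ₛ F′ → G ≈ₛ G′ → F ⊗ G ≈ₛ F′ ⊗ G′
⊗-cong e₁ e₂ p i = Σ≤ℤ-cong p (λ a → Σ≤ℤ-cong i (λ b → cong₂ ℤ._*_ (e₁ a b) (e₂ (p ∸ a) (i ∸ b))))

⊕-cong : ∀ {F F′ G G′} → F ≈ₛ F′ → G ≈ₛ G′ → F ⊕ G ≈ₛ F′ ⊕ G′
⊕-cong e₁ e₂ p i = cong₂ ℤ._+_ (e₁ p i) (e₂ p i)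

·-cong : ∀ c {F F′} → F ≈ₛ F′ → c · F ≈ₛ c · F′
·-cong c e p i = cong (c ℤ.*_) (e p i)

subst-qt-cong : ∀ {F F′} → F ≈ₛ F′ → subst-qt F ≈ₛ subst-qt F′
subst-qt-cong e p i = cong (λ x → if p ≤ᵇ i then x else + 0) (e p (i ∸ p))

ι : NSeries → Series
ι F p i = + F p i

ι-cong : ∀ {F G} → F ≈ₙ G → ι F ≈ₛ ι G
ι-cong e p i = cong +_ (e p i)

ι-⊗ : ∀ F G → ι F ⊗ ι G ≈ₛ ι (F ⊗ₙ G)
ι-⊗ F G p i = trans (Σ≤ℤ-cong p (λ a → trans (Σ≤ℤ-cong i (λ b → sym (ℤP.pos-* (F a b) (G (p ∸ a) (i ∸ b)))))
                                             (Σ≤ℤ-pos i _)))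
                    (Σ≤ℤ-pos p _)

ι-⊕ : ∀ F G → ι F ⊕ ι G ≈ₛ ι (F ⊕ₙ G)
ι-⊕ F G p i = sym (ℤP.pos-+ (F p i) (G p i))

ι-· : ∀ c F → (+ c) · ι F ≈ₛ ι (c ·ₙ F)
ι-· c F p i = sym (ℤP.pos-* c (F p i))

ι-subst : ∀ F → subst-qt (ι F) ≈ₛ ι (substₙ F)
ι-subst F p i with p ≤ᵇ i
... | true  = refl
... | false = refl

𝕥-ι : 𝕥 ≈ₛ ι (tS 𝟙ₙ)
𝕥-ι zero                i       = refl
𝕥-ι (suc zero)          zero    = refl
𝕥-ι (suc zero)          (suc i) = refl
𝕥-ι (suc (suc p))       zero    = refl
𝕥-ι (suc (suc p))       (suc i) = refl

𝕢-ι : 𝕢 ≈ₛ ι (qS 𝟙ₙ)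
𝕢-ι zero    zero          = refl
𝕢-ι (suc p) zero          = refl
𝕢-ι zero    (suc zero)    = refl
𝕢-ι zero    (suc (suc i)) = refl
𝕢-ι (suc p) (suc zero)    = refl
𝕢-ι (suc p) (suc (suc i)) = refl

t-multiple : ∀ c F → (+ c) · 𝕥 ⊗ ι F ≈ₛ ι (c ·ₙ tS F)
t-multiple c F = ⊗-cong (·-cong (+ c) 𝕥-ι ▹ ι-· c (tS 𝟙ₙ)) (≈ₛ-refl {ι F}) ▹ ι-⊗ (c ·ₙ tS 𝟙ₙ) F
  ▹ ι-cong (⊗ₙ-scaled-t c 𝟙ₙ F ▸ ·ₙ-cong c (tS-cong (⊗ₙ-one F)))

qt-multiple : ∀ c F → (+ c) · 𝕢 ⊗ 𝕥 ⊗ ι F ≈ₛ ι (c ·ₙ qS (tS F))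
qt-multiple c F = ⊗-cong qt (≈ₛ-refl {ι F}) ▹ ι-⊗ (c ·ₙ qS (tS 𝟙ₙ)) F
  ▹ ι-cong (⊗ₙ-scaled-qt c 𝟙ₙ F ▸ ·ₙ-cong c (qS-cong (tS-cong (⊗ₙ-one F))))
  where
  qt : (+ c) · 𝕢 ⊗ 𝕥 ≈ₛ ι (c ·ₙ qS (tS 𝟙ₙ))
  qt = ⊗-cong (·-cong (+ c) 𝕢-ι ▹ ι-· c (qS 𝟙ₙ)) 𝕥-ι ▹ ι-⊗ (c ·ₙ qS 𝟙ₙ) (tS 𝟙ₙ)
    ▹ ι-cong (⊗ₙ-scal c (qS 𝟙ₙ) (tS 𝟙ₙ) ▸ ·ₙ-cong c (⊗ₙ-qS 𝟙ₙ (tS 𝟙ₙ) ▸ qS-cong (⊗ₙ-one (tS 𝟙ₙ))))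

rhs-as-ι : ∀ {V : Series} → V ≈ₛ ι Useries →
  V ⊗ subst-qt V ⊕ (+ 2) · 𝕢 ⊗ 𝕥 ⊗ V ⊗ subst-qt 𝒜 ⊕ (+ 2) · 𝕥 ⊗ V ⊗ 𝒜
    ≈ₛ ι (Useries ⊗ₙ substₙ Useries ⊕ₙ 2 ·ₙ qS (tS (Useries ⊗ₙ substₙ A)) ⊕ₙ 2 ·ₙ tS (Useries ⊗ₙ A))
rhs-as-ι {V} V≈ =
  ⊕-cong (⊕-cong first second ▹ ι-⊕ U₁ U₂) third ▹ ι-⊕ (U₁ ⊕ₙ U₂) U₃
  where
  U₁ U₂ U₃ : NSeries
  U₁ = Useries ⊗ₙ substₙ Useries
  U₂ = 2 ·ₙ qS (tS (Useries ⊗ₙ substₙ A))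
  U₃ = 2 ·ₙ tS (Useries ⊗ₙ A)
  first : V ⊗ subst-qt V ≈ₛ ι U₁
  first = ⊗-cong V≈ (subst-qt-cong V≈ ▹ ι-subst Useries) ▹ ι-⊗ Useries (substₙ Useries)
  second : (+ 2) · 𝕢 ⊗ 𝕥 ⊗ V ⊗ subst-qt 𝒜 ≈ₛ ι U₂
  second = ⊗-cong (⊗-cong (≈ₛ-refl {(+ 2) · 𝕢 ⊗ 𝕥}) V≈ ▹ qt-multiple 2 Useries) (ι-subst A)
    ▹ ι-⊗ (2 ·ₙ qS (tS Useries)) (substₙ A)
    ▹ ι-cong (⊗ₙ-scaled-qt 2 Useries (substₙ A))
  third : (+ 2) · 𝕥 ⊗ V ⊗ 𝒜 ≈ₛ ι U₃
  third = ⊗-cong (⊗-cong (≈ₛ-refl {(+ 2) · 𝕥}) V≈ ▹ t-multiple 2 Useries) (≈ₛ-refl {𝒜})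
    ▹ ι-⊗ (2 ·ₙ tS Useries) A
    ▹ ι-cong (⊗ₙ-scaled-t 2 Useries A)

-- Coefficients of √(1 − 4t): 1, and −2 Cat n at t^(n+1).
sqrtCoeff : ℕ → ℤ
sqrtCoeff zero    = + 1
sqrtCoeff (suc n) = ℤ.- (+ (2 * Cat n))

sqrtCoeff-product : ∀ a b → sqrtCoeff (suc a) ℤ.* sqrtCoeff (suc b) ≡ + (4 * (Cat a * Cat b))
sqrtCoeff-product a b = begin
  ℤ.- (+ (2 * x)) ℤ.* ℤ.- (+ (2 * y))          ≡⟨ cong₂ (λ u v → ℤ.- u ℤ.* ℤ.- v) (ℤP.pos-* 2 x) (ℤP.pos-* 2 y) ⟩
  ℤ.- (+ 2 ℤ.* + x) ℤ.* ℤ.- (+ 2 ℤ.* + y)      ≡⟨ arith (+ x) (+ y) ⟩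
  + 4 ℤ.* (+ x ℤ.* + y)                          ≡⟨ cong (+ 4 ℤ.*_) (ℤP.pos-* x y) ⟨
  + 4 ℤ.* + (x * y)                              ≡⟨ ℤP.pos-* 4 (x * y) ⟨
  + (4 * (x * y))                                ∎
  where
  x y : ℕ
  x = Cat a
  y = Cat b
  arith : ∀ u v → ℤ.- (+ 2 ℤ.* u) ℤ.* ℤ.- (+ 2 ℤ.* v) ≡ + 4 ℤ.* (u ℤ.* v)
  arith = ℤ-Ring.solve-∀

-- The coefficient of t^(m+2) in the square of √(1 − 4t) vanishes:
-- 2 · (−2c) + 4c = 0, where 4c = 4 Cat (m+1) collects the middle terms.
sqrtCoeff-balance : ∀ c → (ℤ.- (+ (2 * c)) ℤ.+ + (4 * c)) ℤ.+ ℤ.- (+ (2 * c)) ≡ + 0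
sqrtCoeff-balance c = begin
  (ℤ.- (+ (2 * c)) ℤ.+ + (4 * c)) ℤ.+ ℤ.- (+ (2 * c))
    ≡⟨ cong₂ (λ u v → (ℤ.- u ℤ.+ v) ℤ.+ ℤ.- u) (ℤP.pos-* 2 c) (ℤP.pos-* 4 c) ⟩
  (ℤ.- (+ 2 ℤ.* + c) ℤ.+ + 4 ℤ.* + c) ℤ.+ ℤ.- (+ 2 ℤ.* + c)
    ≡⟨ arith (+ c) ⟩
  + 0 ∎
  where
  arith : ∀ u → (ℤ.- (+ 2 ℤ.* u) ℤ.+ + 4 ℤ.* u) ℤ.+ ℤ.- (+ 2 ℤ.* u) ≡ + 0
  arith = ℤ-Ring.solve-∀

double-cancel : ∀ M x y → (x ℤ.+ M) ℤ.+ x ≡ (y ℤ.+ M) ℤ.+ y → x ≡ y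
double-cancel M x y e = ℤP.*-cancelˡ-≡ (+ 2) x y (begin
  + 2 ℤ.* x                     ≡⟨ arith M x ⟩
  ((x ℤ.+ M) ℤ.+ x) ℤ.- M       ≡⟨ cong (ℤ._- M) e ⟩
  ((y ℤ.+ M) ℤ.+ y) ℤ.- M       ≡⟨ arith M y ⟨
  + 2 ℤ.* y                     ∎)
  where
  arith : ∀ M x → + 2 ℤ.* x ≡ ((x ℤ.+ M) ℤ.+ x) ℤ.- M
  arith = ℤ-Ring.solve-∀

module SquareRoot (s : ℕ → ℤ) (s₀ : s 0 ≡ + 1) (s² : embedT s ⊗ embedT s ≈ₛ 𝟙 ⊖ (+ 4) · 𝕥) where

  s₀-left : ∀ x → s 0 ℤ.* x ≡ x
  s₀-left x = trans (cong (ℤ._* x) s₀) (ℤP.*-identityˡ x)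

  s₀-right : ∀ x → x ℤ.* s 0 ≡ x
  s₀-right x = trans (cong (x ℤ.*_) s₀) (ℤP.*-identityʳ x)

  -- Strong induction: the coefficient of t^n in s² = 1 − 4t determines s_n
  -- from the earlier coefficients.
  s-coefficients : ∀ n → s n ≡ sqrtCoeff n
  s-coefficients = <-rec (λ n → s n ≡ sqrtCoeff n) step
    where
    step : ∀ n → (∀ {m} → m < n → s m ≡ sqrtCoeff m) → s n ≡ sqrtCoeff n
    step zero          _  = s₀
    step (suc zero)    _  = double-cancel (+ 0) (s 1) (sqrtCoeff 1) (begin
      (s 1 ℤ.+ + 0) ℤ.+ s 1        ≡⟨ cong (ℤ._+ s 1) (ℤP.+-identityʳ (s 1)) ⟩
      s 1 ℤ.+ s 1                  ≡⟨ cong₂ ℤ._+_ (s₀-left (s 1)) (s₀-right (s 1)) ⟨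
      s 0 ℤ.* s 1 ℤ.+ s 1 ℤ.* s 0  ≡⟨ s² 1 0 ⟩
      (sqrtCoeff 1 ℤ.+ + 0) ℤ.+ sqrtCoeff 1 ∎)
    step (suc (suc m)) ih = double-cancel M x (sqrtCoeff (2 + m)) (begin
      (x ℤ.+ M) ℤ.+ x
        ≡⟨ cong₂ (λ u v → (u ℤ.+ M) ℤ.+ v) (s₀-left x) (trans (cong (λ k → x ℤ.* s k) (n∸n≡0 m)) (s₀-right x)) ⟨
      (s 0 ℤ.* x ℤ.+ M) ℤ.+ x ℤ.* s (m ∸ m)
        ≡⟨ cong (λ u → (s 0 ℤ.* x ℤ.+ u) ℤ.+ x ℤ.* s (m ∸ m)) middle ⟨
      (s 0 ℤ.* x ℤ.+ Σ≤ℤ m (λ a → s (suc a) ℤ.* s (suc m ∸ a))) ℤ.+ x ℤ.* s (m ∸ m)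
        ≡⟨ cong (ℤ._+ x ℤ.* s (m ∸ m)) (Σ≤ℤ-head m (λ a → s a ℤ.* s (2 + m ∸ a))) ⟨
      Σ≤ℤ (2 + m) (λ a → s a ℤ.* s (2 + m ∸ a))
        ≡⟨ s² (2 + m) 0 ⟩
      + 0
        ≡⟨ sqrtCoeff-balance (Cat (suc m)) ⟨
      (sqrtCoeff (2 + m) ℤ.+ M) ℤ.+ sqrtCoeff (2 + m) ∎)
      where
      x M : ℤ
      x = s (2 + m)
      M = + (4 * Cat (suc m))
      middle : Σ≤ℤ m (λ a → s (suc a) ℤ.* s (suc m ∸ a)) ≡ M
      middle = begin
        Σ≤ℤ m (λ a → s (suc a) ℤ.* s (suc m ∸ a))         ≡⟨ Σ≤ℤ-cong≤ m inner ⟩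
        Σ≤ℤ m (λ a → + (4 * (Cat a * Cat (m ∸ a))))      ≡⟨ Σ≤ℤ-pos m _ ⟩
        + Σ≤ m (λ a → 4 * (Cat a * Cat (m ∸ a)))         ≡⟨ cong +_ (Σ≤-* m 4 _) ⟩
        + (4 * Σ≤ m (λ a → Cat a * Cat (m ∸ a)))         ≡⟨ cong (λ z → + (4 * z)) (catalan-convolution m) ⟨
        M                                               ∎
        where
        inner : ∀ a → a ≤ m → s (suc a) ℤ.* s (suc m ∸ a) ≡ + (4 * (Cat a * Cat (m ∸ a)))
        inner a a≤m = begin
          s (suc a) ℤ.* s (suc m ∸ a)                   ≡⟨ cong (λ k → s (suc a) ℤ.* s k) (+-∸-assoc 1 a≤m) ⟩
          s (suc a) ℤ.* s (suc (m ∸ a))                 ≡⟨ cong₂ ℤ._*_ (ih (s≤s (s≤s a≤m))) (ih (s≤s (s≤s (m∸n≤m m a)))) ⟩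
          sqrtCoeff (suc a) ℤ.* sqrtCoeff (suc (m ∸ a)) ≡⟨ sqrtCoeff-product a (m ∸ a) ⟩
          + (4 * (Cat a * Cat (m ∸ a)))                 ∎

  one-minus-s : 𝟙 ⊖ embedT s ≈ₛ ι Useries
  one-minus-s zero    zero    = cong (λ v → + 1 ℤ.- v) s₀
  one-minus-s (suc n) zero    = begin
    + 0 ℤ.- s (suc n)                  ≡⟨ cong (λ v → + 0 ℤ.- v) (s-coefficients (suc n)) ⟩
    + 0 ℤ.+ ℤ.- ℤ.- (+ (2 * Cat n))    ≡⟨ ℤP.+-identityˡ _ ⟩
    ℤ.- ℤ.- (+ (2 * Cat n))            ≡⟨ ℤP.neg-involutive _ ⟩
    + (2 * Cat n)                      ∎
  one-minus-s zero    (suc i) = refl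
  one-minus-s (suc p) (suc i) = refl

-- The recurrence; and the generating function identity, obtained by moving
-- both sides to natural-coefficient series, where it is generating-identityₙ.
lemma6 : (∀ (p i : ℕ) → A (suc p) i
            ≡ Σ≤ p (λ k → Cat k * Cat (p ∸ k) * qpow (suc k) i
                          + Cat (p ∸ k) * shiftq (suc k) (A k) i
                          + Cat k * A (p ∸ k) i))
         × (∀ (s : ℕ → ℤ) → s 0 ≡ + 1 → embedT s ⊗ embedT s ≈ₛ 𝟙 ⊖ (+ 4) · 𝕥
            → (+ 4) · 𝕥 ⊗ 𝒜
              ≈ₛ (𝟙 ⊖ embedT s) ⊗ subst-qt (𝟙 ⊖ embedT s)
                 ⊕ (+ 2) · 𝕢 ⊗ 𝕥 ⊗ (𝟙 ⊖ embedT s) ⊗ subst-qt 𝒜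
                 ⊕ (+ 2) · 𝕥 ⊗ (𝟙 ⊖ embedT s) ⊗ 𝒜)
lemma6 = avalanche-recurrence , λ s s₀ s² →
  t-multiple 4 A ▹ ι-cong generating-identityₙ ▹ ≈ₛ-sym (rhs-as-ι (SquareRoot.one-minus-s s s₀ s²))
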